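{- Let $M$ be a model of $T$. For any two vertices $x,y\in M$ there are only finitely many geodesics from $x$ to $y$.
   Context: Graphs are simple undirected graphs in the language $\{E\}$; subgraphs are induced. A vertex $x$ of a graph $A$ is removable from $A$ if it has at most one neighbour in $A$, or exactly two neighbours in $A$ which are adjacent. $T$ is the theory of graphs stating: (1) every edge is contained in exactly two triangles; (2) every finite subgraph has a removable vertex. The distance $d(x,y)$ is the length of a shortest path from $x$ to $y$; a geodesic from $x$ to $y$ is a path from $x$ to $y$ of length $d(x,y)$. -}

module Defs where

open import Level using (0ℓ)
open import Data.Nat using (ℕ; _<_)
open import Data.List using (List; []; _∷_; length)
open import Data.List.Membership.Propositional using (_∈_)
open import Data.List.Relation.Unary.Unique.Propositional using (Unique)
open import Data.Product using (Σ; _×_; _,_; ∃)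
open import Data.Sum using (_⊎_)
open import Data.Empty using (⊥)
open import Relation.Nullary using (¬_)
open import Relation.Binary.PropositionalEquality using (_≡_; _≢_)

record Graph : Set₁ where
  field
    V    : Set
    E    : V → V → Set
    irr  : ∀ {x} → ¬ E x x
    sym  : ∀ {x y} → E x y → E y x

module _ (G : Graph) where
  open Graph G

  -- (1) every edge is contained in exactly two triangles:
  -- for an edge xy there are two distinct common neighbours z₁ z₂ and no others.
  EdgeInTwoTriangles : Set
  EdgeInTwoTriangles =
    ∀ x y → E x y →
      Σ V λ z₁ → Σ V λ z₂ →
        z₁ ≢ z₂ × (E x z₁ × E y z₁) × (E x z₂ × E y z₂) ×
        (∀ w → E x w → E y w → w ≡ z₁ ⊎ w ≡ z₂)

  Removable : List V → V → Set
  Removable A x =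
    (∀ y z → y ∈ A → z ∈ A → E x y → E x z → y ≡ z)
    ⊎ (Σ V λ y → Σ V λ z →
         y ∈ A × z ∈ A × y ≢ z × E x y × E x z × E y z ×
         (∀ w → w ∈ A → E x w → w ≡ y ⊎ w ≡ z))

  -- (2) every (nonempty) finite subgraph has a removable vertex.
  -- A finite subgraph is given by a duplicate-free nonempty list of its vertices.
  FiniteHasRemovable : Set
  FiniteHasRemovable =
    ∀ (A : List V) → Unique A → A ≢ [] →
      Σ V λ x → x ∈ A × Removable A x

  ModelOfT : Set
  ModelOfT = EdgeInTwoTriangles × FiniteHasRemovable

  data IsWalk : V → V → List V → Set where
    single : ∀ {x} → IsWalk x x (x ∷ [])
    step   : ∀ {x z y vs} → E x z → IsWalk z y (z ∷ vs) → IsWalk x y (x ∷ z ∷ vs)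

  IsPath : V → V → List V → Set
  IsPath x y vs = IsWalk x y vs × Unique vs

  -- length of a path = number of edges = (number of vertices) - 1;
  -- we compare via number of vertices, which is equivalent.
  IsGeodesic : V → V → List V → Set
  IsGeodesic x y vs =
    IsPath x y vs × (∀ ws → IsPath x y ws → ¬ (length ws < length vs))

  FinitelyManyGeodesics : V → V → Set
  FinitelyManyGeodesics x y =
    Σ (List (List V)) λ L → ∀ vs → IsGeodesic x y vs → vs ∈ L

-- An interior vertex of a geodesic has two distinct non-adjacent neighbours on it, so it is not
-- removable from any finite subgraph containing the geodesic. Hence, if both x and y were the
-- start of geodesics towards each other with three distinct second vertices, the finite union
-- of these six geodesics would have no removable vertex at all: interior vertices are excluded
-- as above, and x and y each have three neighbours in it. So on one side there are at most two
-- possible second vertices, and by induction on the length (reversing the geodesics if that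
-- side is y) there are only finitely many geodesics of each length; all geodesics from x to y
-- have the same length.

module Submission where

open import Defs
open import Axiom.ExcludedMiddle using (ExcludedMiddle)
open import Level using (0ℓ)

open import Data.Nat using (ℕ; zero; suc; _<_; _≤_; s≤s)
open import Data.Nat.Properties using (≤-refl; ≤-trans; ≤-<-trans; n≤1+n; ≮⇒≥; ≤-antisym; suc-injective)
open import Data.List using (List; []; _∷_; length; _++_; _∷ʳ_; reverse; map; concat; deduplicate)
open import Data.List.Properties using (unfold-reverse; reverse-involutive; length-reverse)
open import Data.List.Membership.Propositional using (_∈_; _∉_)
open import Data.List.Membership.Propositional.Properties
  using (∈-map⁺; ∈-concat⁺′; ∈-concat⁻′; ∈-++⁺ˡ; ∈-++⁺ʳ; ∈-++⁻; ∈-deduplicate⁺; ∈-deduplicate⁻)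
open import Data.List.Relation.Binary.Subset.Propositional using (_⊆_)
import Data.List.Relation.Binary.Permutation.Setoid as Permutation
import Data.List.Relation.Binary.Permutation.Setoid.Properties as Permutation
open import Data.List.Relation.Unary.Any using (here; there)
open import Data.List.Relation.Unary.All using (All; []; _∷_)
import Data.List.Relation.Unary.All as All
open import Data.List.Relation.Unary.All.Properties using (¬Any⇒All¬)
open import Data.List.Relation.Unary.AllPairs using (_∷_)
open import Data.List.Relation.Unary.Unique.Propositional using (Unique)
open import Data.List.Relation.Unary.Unique.DecPropositional.Properties using (deduplicate-!)
open import Data.Product using (Σ; _×_; _,_; proj₁; proj₂)
open import Data.Sum using (_⊎_; inj₁; inj₂; [_,_]′)
import Data.Sum as Sum
open import Data.Empty using (⊥; ⊥-elim)
open import Relation.Nullary using (¬_; yes; no)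
open import Relation.Nullary.Decidable using (¬¬-excluded-middle)
open import Relation.Binary.Definitions using (DecidableEquality)
open import Relation.Binary.PropositionalEquality using (_≡_; _≢_; refl; sym; trans; subst; subst₂; setoid)
open import Function using (_∘_)

module _ {A : Set} where

  Listable : (A → Set) → Set
  Listable P = Σ (List A) λ L → ∀ z → P z → z ∈ L

  ThreeDistinct : (A → Set) → Set
  ThreeDistinct P = Σ A λ a → Σ A λ b → Σ A λ c →
    P a × P b × P c × b ≢ a × c ≢ a × c ≢ b

  module _ (em : ExcludedMiddle 0ℓ) (P : A → Set) where

    covered⊎escapes : (L : List A) → (∀ z → P z → z ∈ L) ⊎ (Σ A λ z → P z × z ∉ L)
    covered⊎escapes L with em {Σ A λ z → P z × z ∉ L}
    ... | yes escape = inj₂ escape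
    ... | no ¬escape = inj₁ covered
      where
        covered : ∀ z → P z → z ∈ L
        covered z pz with em {z ∈ L}
        ... | yes z∈L = z∈L
        ... | no z∉L  = ⊥-elim (¬escape (z , pz , z∉L))

    ¬ThreeDistinct⇒Listable : ¬ ThreeDistinct P → Listable P
    ¬ThreeDistinct⇒Listable ¬three with covered⊎escapes []
    ... | inj₁ covered = [] , covered
    ... | inj₂ (a , pa , _) with covered⊎escapes (a ∷ [])
    ...   | inj₁ covered = a ∷ [] , covered
    ...   | inj₂ (b , pb , b∉) with covered⊎escapes (a ∷ b ∷ [])
    ...     | inj₁ covered = a ∷ b ∷ [] , covered
    ...     | inj₂ (c , pc , c∉) = ⊥-elim (¬three (a , b , c , pa , pb , pc ,
                                     b∉ ∘ here , c∉ ∘ here , c∉ ∘ there ∘ here))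

module _ (G : Graph) where
  open Graph G renaming (sym to E-sym)

  IsWalk-∷ : ∀ {x z y ps} → E x z → IsWalk G z y ps → IsWalk G x y (x ∷ ps)
  IsWalk-∷ xz single       = step xz single
  IsWalk-∷ xz (step zw ws) = step xz (step zw ws)

  IsWalk-∷ʳ : ∀ {x z y ps} → IsWalk G x z ps → E z y → IsWalk G x y (ps ∷ʳ y)
  IsWalk-∷ʳ single       zy = step zy single
  IsWalk-∷ʳ (step xw ws) zy = step xw (IsWalk-∷ʳ ws zy)

  IsWalk-reverse : ∀ {x y ps} → IsWalk G x y ps → IsWalk G y x (reverse ps)
  IsWalk-reverse single = single
  IsWalk-reverse {x} (step {z = z} {vs = vs} xz ws) =
    subst (IsWalk G _ x) (sym (unfold-reverse x (z ∷ vs))) (IsWalk-∷ʳ (IsWalk-reverse ws) (E-sym xz))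

  IsPath-suffix : ∀ {v x y ps} → v ∈ ps → IsPath G x y ps →
    Σ (List V) λ qs → IsPath G v y qs × length qs ≤ length ps
  IsPath-suffix (here refl) p@(single , _)   = _ , p , ≤-refl
  IsPath-suffix (here refl) p@(step _ _ , _) = _ , p , ≤-refl
  IsPath-suffix (there v∈) (step _ ws , _ ∷ u) =
    let qs , q , qs≤ = IsPath-suffix v∈ (ws , u) in qs , q , ≤-trans qs≤ (n≤1+n _)

  IsGeodesic-reverse : ∀ {x y ps} → IsGeodesic G x y ps → IsGeodesic G y x (reverse ps)
  IsGeodesic-reverse {ps = ps} ((w , u) , shortest) =
    (IsWalk-reverse w , reverse-unique u) , λ qs (w′ , u′) qs<ps →
      shortest (reverse qs) (IsWalk-reverse w′ , reverse-unique u′)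
        (subst₂ _<_ (sym (length-reverse qs)) (length-reverse ps) qs<ps)
    where
      reverse-unique : ∀ {vs} → Unique vs → Unique (reverse vs)
      reverse-unique {vs} = Permutation.Unique-resp-↭ (setoid V)
        (Permutation.↭-sym (setoid V) (Permutation.↭-reverse (setoid V) vs))

  IsGeodesic-length : ∀ {x y ps qs} → IsGeodesic G x y ps → IsGeodesic G x y qs →
    length ps ≡ length qs
  IsGeodesic-length (p , p-shortest) (q , q-shortest) =
    ≤-antisym (≮⇒≥ (p-shortest _ q)) (≮⇒≥ (q-shortest _ p))

  -- If x reappears on the shorter path ws, its suffix starting at x is shorter still.
  IsGeodesic-tail : ∀ {x z y rest} → IsGeodesic G x y (x ∷ z ∷ rest) → IsGeodesic G z y (z ∷ rest)
  IsGeodesic-tail {x} ((step xz w , _ ∷ u) , shortest) =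
    (w , u) , λ ws (w′ , u′) ws<rest → ¬¬-excluded-middle λ where
      (yes x∈ws) → let qs , q , qs≤ws = IsPath-suffix x∈ws (w′ , u′)
                   in shortest qs q (≤-<-trans qs≤ws (≤-trans ws<rest (n≤1+n _)))
      (no x∉ws)  → shortest (x ∷ ws) (IsWalk-∷ xz w′ , ¬Any⇒All¬ ws x∉ws ∷ u′) (s≤s ws<rest)

  StartsGeodesic : V → V → V → Set
  StartsGeodesic x y z = Σ (List V) λ rest → IsGeodesic G x y (x ∷ z ∷ rest)

  StartsGeodesic-edge : ∀ {x y z} → StartsGeodesic x y z → E x z
  StartsGeodesic-edge (_ , (step xz _ , _) , _) = xz

  HasNonAdjacentNeighbours : List V → V → Set
  HasNonAdjacentNeighbours A v = Σ V λ a → Σ V λ b →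
    a ∈ A × b ∈ A × E v a × E v b × a ≢ b × ¬ E a b

  HasNonAdjacentNeighbours-mono : ∀ {A B v} → A ⊆ B →
    HasNonAdjacentNeighbours A v → HasNonAdjacentNeighbours B v
  HasNonAdjacentNeighbours-mono A⊆B (a , b , a∈ , b∈ , rest) = a , b , A⊆B a∈ , A⊆B b∈ , rest

  -- The two neighbours of an interior vertex are not adjacent, else the geodesic could skip it.
  IsGeodesic-interior : ∀ {x y ps v} → IsGeodesic G x y ps → v ∈ ps →
    v ≡ x ⊎ v ≡ y ⊎ HasNonAdjacentNeighbours ps v
  IsGeodesic-interior ((single , _) , _)     (here refl) = inj₁ refl
  IsGeodesic-interior ((step _ _ , _) , _)   (here refl) = inj₁ refl
  IsGeodesic-interior g@((step _ _ , _) , _) (there v∈) with IsGeodesic-interior (IsGeodesic-tail g) v∈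
  ... | inj₂ (inj₁ v≡y) = inj₂ (inj₁ v≡y)
  ... | inj₂ (inj₂ n)   = inj₂ (inj₂ (HasNonAdjacentNeighbours-mono there n))
  IsGeodesic-interior ((step _ single , _) , _) _ | inj₁ refl = inj₂ (inj₁ refl)
  IsGeodesic-interior ((step xv (step vw w) , (_ ∷ x≢w ∷ x∉) ∷ (_ ∷ u)) , shortest) _ | inj₁ refl =
    inj₂ (inj₂ (_ , _ , here refl , there (there (here refl)) , E-sym xv , vw , x≢w ,
      λ xw → shortest _ (step xw w , (x≢w ∷ x∉) ∷ u) ≤-refl))

  HasNonAdjacentNeighbours⇒¬Removable : ∀ {A v} → HasNonAdjacentNeighbours A v → ¬ Removable G A v
  HasNonAdjacentNeighbours⇒¬Removable (_ , _ , a∈ , b∈ , va , vb , a≢b , _) (inj₁ atMostOne) =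
    a≢b (atMostOne _ _ a∈ b∈ va vb)
  HasNonAdjacentNeighbours⇒¬Removable (_ , _ , a∈ , b∈ , va , vb , a≢b , ¬ab)
    (inj₂ (_ , _ , _ , _ , _ , _ , _ , pq , onlyTwo)) with onlyTwo _ a∈ va | onlyTwo _ b∈ vb
  ... | inj₁ refl | inj₁ refl = a≢b refl
  ... | inj₁ refl | inj₂ refl = ¬ab pq
  ... | inj₂ refl | inj₁ refl = ¬ab (E-sym pq)
  ... | inj₂ refl | inj₂ refl = a≢b refl

  ThreeNeighbours⇒¬Removable : ∀ {A v} → ThreeDistinct (λ z → z ∈ A × E v z) → ¬ Removable G A v
  ThreeNeighbours⇒¬Removable (_ , _ , _ , (a∈ , va) , (b∈ , vb) , _ , b≢a , _ , _) (inj₁ atMostOne) =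
    b≢a (atMostOne _ _ b∈ a∈ vb va)
  ThreeNeighbours⇒¬Removable (_ , _ , _ , (a∈ , va) , (b∈ , vb) , (c∈ , vc) , b≢a , c≢a , c≢b)
    (inj₂ (_ , _ , _ , _ , _ , _ , _ , _ , onlyTwo))
    with onlyTwo _ a∈ va | onlyTwo _ b∈ vb | onlyTwo _ c∈ vc
  ... | inj₁ refl | inj₁ refl | _         = b≢a refl
  ... | inj₂ refl | inj₂ refl | _         = b≢a refl
  ... | inj₁ refl | _         | inj₁ refl = c≢a refl
  ... | inj₂ refl | _         | inj₂ refl = c≢a refl
  ... | _         | inj₁ refl | inj₁ refl = c≢b refl
  ... | _         | inj₂ refl | inj₂ refl = c≢b refl

  ThreeDirections : V → V → Set
  ThreeDirections x y = ThreeDistinct (StartsGeodesic x y)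

  geodesicsOf : ∀ {x y} → ThreeDirections x y → List (List V)
  geodesicsOf {x} (a , b , c , (ra , _) , (rb , _) , (rc , _) , _) =
    (x ∷ a ∷ ra) ∷ (x ∷ b ∷ rb) ∷ (x ∷ c ∷ rc) ∷ []

  geodesicsOf-IsGeodesic : ∀ {x y} (t : ThreeDirections x y) → All (IsGeodesic G x y) (geodesicsOf t)
  geodesicsOf-IsGeodesic (_ , _ , _ , (_ , ga) , (_ , gb) , (_ , gc) , _) = ga ∷ gb ∷ gc ∷ []

  ThreeDirections⇒¬Removable : ∀ {x y H} (t : ThreeDirections x y) → concat (geodesicsOf t) ⊆ H →
    ¬ Removable G H x
  ThreeDirections⇒¬Removable {x} {H = H} t@(a , b , c , sa , sb , sc , distinct) ⊆H =
    ThreeNeighbours⇒¬Removable (a , b , c ,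
      (second (here refl) , StartsGeodesic-edge sa) ,
      (second (there (here refl)) , StartsGeodesic-edge sb) ,
      (second (there (there (here refl))) , StartsGeodesic-edge sc) , distinct)
    where
      second : ∀ {z rest} → (x ∷ z ∷ rest) ∈ geodesicsOf t → z ∈ H
      second P∈ = ⊆H (∈-concat⁺′ (there (here refl)) P∈)

  Removable-on-geodesics : ∀ {x y H v Ps} → All (IsGeodesic G x y) Ps → concat Ps ⊆ H →
    v ∈ concat Ps → Removable G H v → v ≡ x ⊎ v ≡ y
  Removable-on-geodesics {Ps = Ps} geodesics ⊆H v∈ removable
    with P , v∈P , P∈Ps ← ∈-concat⁻′ Ps v∈
    with IsGeodesic-interior (All.lookup geodesics P∈Ps) v∈P
  ... | inj₁ v≡x        = inj₁ v≡x
  ... | inj₂ (inj₁ v≡y) = inj₂ v≡y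
  ... | inj₂ (inj₂ n)   = ⊥-elim (HasNonAdjacentNeighbours⇒¬Removable
                            (HasNonAdjacentNeighbours-mono (λ u∈P → ⊆H (∈-concat⁺′ u∈P P∈Ps)) n)
                            removable)

  ¬ThreeDirections-both : FiniteHasRemovable G → DecidableEquality V →
    ∀ {x y} → ThreeDirections x y → ThreeDirections y x → ⊥
  -- Vs begins with x, so H ≢ [] holds by computation.
  ¬ThreeDirections-both removable _≟_ {x} {y} txy tyx =
    let v , v∈H , v-removable = removable H (deduplicate-! _≟_ Vs) (λ ())
    in ¬Removable (∈-deduplicate⁻ _≟_ Vs v∈H) v-removable
    where
      Vs : List V
      Vs = concat (geodesicsOf txy) ++ concat (geodesicsOf tyx)
      H : List V
      H = deduplicate _≟_ Vs
      xy⊆H : concat (geodesicsOf txy) ⊆ H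
      xy⊆H = ∈-deduplicate⁺ _≟_ ∘ ∈-++⁺ˡ {ys = concat (geodesicsOf tyx)}
      yx⊆H : concat (geodesicsOf tyx) ⊆ H
      yx⊆H = ∈-deduplicate⁺ _≟_ ∘ ∈-++⁺ʳ (concat (geodesicsOf txy))
      endpoint : ∀ {v} → v ∈ Vs → Removable G H v → v ≡ x ⊎ v ≡ y
      endpoint v∈ v-removable with ∈-++⁻ _ v∈
      ... | inj₁ v∈xy = Removable-on-geodesics (geodesicsOf-IsGeodesic txy) xy⊆H v∈xy v-removable
      ... | inj₂ v∈yx =
        Sum.swap (Removable-on-geodesics (geodesicsOf-IsGeodesic tyx) yx⊆H v∈yx v-removable)
      ¬Removable : ∀ {v} → v ∈ Vs → ¬ Removable G H v
      ¬Removable v∈ v-removable with endpoint v∈ v-removable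
      ... | inj₁ refl = ThreeDirections⇒¬Removable txy xy⊆H v-removable
      ... | inj₂ refl = ThreeDirections⇒¬Removable tyx yx⊆H v-removable

  GeodesicOfLength : ℕ → V → V → List V → Set
  GeodesicOfLength n x y ps = IsGeodesic G x y ps × length ps ≡ n

  GeodesicOfLength-reverse : ∀ {n x y} → Listable (GeodesicOfLength n y x) →
    Listable (GeodesicOfLength n x y)
  GeodesicOfLength-reverse (L , ∈L) = map reverse L , λ ps (g , len) →
    subst (_∈ map reverse L) (reverse-involutive ps)
      (∈-map⁺ reverse (∈L (reverse ps) (IsGeodesic-reverse g , trans (length-reverse ps) len)))

  GeodesicOfLength-directions : ∀ {n x y} → Listable (StartsGeodesic x y) →
    (∀ z → Listable (GeodesicOfLength (suc n) z y)) → Listable (GeodesicOfLength (suc (suc n)) x y)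
  GeodesicOfLength-directions {n} {x} {y} (Zs , ∈Zs) tails = concat (map through Zs) , covers
    where
      through : V → List (List V)
      through z = map (x ∷_) (proj₁ (tails z))
      covers : ∀ ps → GeodesicOfLength (suc (suc n)) x y ps → ps ∈ concat (map through Zs)
      covers [] (((() , _) , _) , _)
      covers (_ ∷ []) (_ , ())
      covers (_ ∷ z ∷ rest) (g@((step _ _ , _) , _) , len) =
        ∈-concat⁺′ (∈-map⁺ (x ∷_) (proj₂ (tails z) _ (IsGeodesic-tail g , suc-injective len)))
                   (∈-map⁺ through (∈Zs z (rest , g)))

  module _ (em : ExcludedMiddle 0ℓ) (removable : FiniteHasRemovable G) where

    ¬ThreeDirections-one-side : ∀ x y → ¬ ThreeDirections x y ⊎ ¬ ThreeDirections y x
    ¬ThreeDirections-one-side x y with em {ThreeDirections x y}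
    ... | no ¬txy = inj₁ ¬txy
    ... | yes txy = inj₂ (¬ThreeDirections-both removable (λ _ _ → em) txy)

    GeodesicOfLength-listable : ∀ n x y → Listable (GeodesicOfLength n x y)
    GeodesicOfLength-listable zero x y = [] , λ where
      [] (((() , _) , _) , _)
      (_ ∷ _) (_ , ())
    GeodesicOfLength-listable (suc zero) x y = (x ∷ []) ∷ [] , λ where
      [] (((() , _) , _) , _)
      (_ ∷ []) (((single , _) , _) , _) → here refl
      (_ ∷ _ ∷ _) (_ , ())
    GeodesicOfLength-listable (suc (suc n)) x y =
      [ (λ ¬txy → GeodesicOfLength-directions (¬ThreeDistinct⇒Listable em _ ¬txy)
                    (λ z → GeodesicOfLength-listable (suc n) z y))
      , (λ ¬tyx → GeodesicOfLength-reverse (GeodesicOfLength-directions (¬ThreeDistinct⇒Listable em _ ¬tyx)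
                    (λ z → GeodesicOfLength-listable (suc n) z x)))
      ]′ (¬ThreeDirections-one-side x y)

lemma3p1 : ExcludedMiddle 0ℓ → (M : Graph) → ModelOfT M →
    ∀ (x y : Graph.V M) → FinitelyManyGeodesics M x y
lemma3p1 em M (_ , removable) x y with em {Σ (List (Graph.V M)) (IsGeodesic M x y)}
... | no noGeodesic = [] , λ ps g → ⊥-elim (noGeodesic (ps , g))
... | yes (ps₀ , g₀) =
  let L , ∈L = GeodesicOfLength-listable M em removable (length ps₀) x y
  in L , λ ps g → ∈L ps (g , IsGeodesic-length M g g₀)
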